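{- Let $n\geq 2$ and $v\geq 2$. Then $\mathrm{Aut}(\Gamma'(n,v))$ has order $v!\,\big((v-1)!\big)^{n-1}$ and is isomorphic to $S_v\times S_{v-1}^{\,n-1}$.
   Context: The graph $\Gamma'(n,v)$ has vertex set $\{(i,j):0\leq i\leq n-1,\ 0\leq j\leq v-1\}$ and is obtained from the complete graph on this vertex set by removing all edges joining $(i,0)$ to $(k,\ell)$ for all $0\leq i\leq n-2$, $i<k\leq n-1$, $0\leq \ell\leq v-1$. $S_m$ denotes the symmetric group of degree $m$. -}

module Defs where

open import Level using (0ℓ)
open import Data.Nat using (ℕ; zero; suc; _∸_)
open import Data.Fin using (Fin; toℕ; _<_)
open import Data.Product using (_×_; _,_; proj₁; proj₂)
open import Relation.Nullary using (¬_)
open import Relation.Binary.PropositionalEquality using (_≡_; refl; sym; trans; cong)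
open import Relation.Binary.Bundles using (Setoid)
open import Function.Bundles using (_↔_; Inverse)
open import Function.Construct.Composition using (_↔-∘_)
open import Data.Fin.Permutation using (Permutation′; _⟨$⟩ʳ_; _∘ₚ_)

Vertex : ℕ → ℕ → Set
Vertex n v = Fin n × Fin v

-- Removed x y : x = (i,0) and y = (k,ℓ) with i < k  (an edge deleted from K_{nv}).
Removed : ∀ {n v} → Vertex n v → Vertex n v → Set
Removed (i , j) (k , ℓ) = (toℕ j ≡ 0) × (i < k)

Adj : ∀ {n v} → Vertex n v → Vertex n v → Set
Adj x y = ¬ (x ≡ y) × ¬ Removed x y × ¬ Removed y x

record Aut (n v : ℕ) : Set where
  field
    perm     : Vertex n v ↔ Vertex n v
    preserve : ∀ x y → Adj x y → Adj (Inverse.to perm x) (Inverse.to perm y)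
    reflect  : ∀ x y → Adj (Inverse.to perm x) (Inverse.to perm y) → Adj x y
open Aut public

app : ∀ {n v} → Aut n v → Vertex n v → Vertex n v
app g = Inverse.to (perm g)

_≈ₐ_ : ∀ {n v} → Aut n v → Aut n v → Set
g ≈ₐ h = ∀ x → app g x ≡ app h x

AutSetoid : ℕ → ℕ → Setoid 0ℓ 0ℓ
AutSetoid n v = record
  { Carrier = Aut n v
  ; _≈_ = _≈ₐ_
  ; isEquivalence = record
    { refl = λ x → refl
    ; sym = λ p x → sym (p x)
    ; trans = λ p q x → trans (p x) (q x)
    }
  }

-- Group operation of Aut(Γ'(n,v)): composition, "first g then h",
-- matching the convention of Data.Fin.Permutation._∘ₚ_.
_∘ₐ_ : ∀ {n v} → Aut n v → Aut n v → Aut n v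
g ∘ₐ h = record
  { perm = perm h ↔-∘ perm g
  ; preserve = λ x y a → preserve h _ _ (preserve g x y a)
  ; reflect = λ x y a → reflect g x y (reflect h _ _ a)
  }

Sym : ℕ → Set
Sym m = Permutation′ m

Prod : ℕ → ℕ → Set
Prod n v = Sym v × (Fin (n ∸ 1) → Sym (v ∸ 1))

_≈ₚ_ : ∀ {n v} → Prod n v → Prod n v → Set
_≈ₚ_ {n} {v} (σ , τ) (σ′ , τ′) =
  (∀ a → σ ⟨$⟩ʳ a ≡ σ′ ⟨$⟩ʳ a) × (∀ i b → τ i ⟨$⟩ʳ b ≡ τ′ i ⟨$⟩ʳ b)

ProdSetoid : ℕ → ℕ → Setoid 0ℓ 0ℓ
ProdSetoid n v = record
  { Carrier = Prod n v
  ; _≈_ = _≈ₚ_ {n} {v}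
  ; isEquivalence = record
    { refl = (λ a → refl) , (λ i b → refl)
    ; sym = λ p → (λ a → sym (proj₁ p a)) , (λ i b → sym (proj₂ p i b))
    ; trans = λ p q → (λ a → trans (proj₁ p a) (proj₁ q a))
                    , (λ i b → trans (proj₂ p i b) (proj₂ q i b))
    }
  }

_∙ₚ_ : ∀ {n v} → Prod n v → Prod n v → Prod n v
(σ , τ) ∙ₚ (σ′ , τ′) = (σ ∘ₚ σ′) , (λ i → τ i ∘ₚ τ′ i)

-- Call two vertices cut if the edge between them was removed; automorphisms preserve and
-- reflect cuts. By strong induction on i, an automorphism f fixes (i,0) whenever row i is not
-- the last. Write f(i,0) = (a,b). If a > i, pick c ≠ b and let y = f⁻¹(a,c). Since (a,b) and
-- (a,c) share a row, y is not cut from (i,0); being distinct from (i,0), y then has a nonzero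
-- column in a row k ≤ i. As (i,0) is cut from (a,c), f⁻¹(i,0) is cut from y, so
-- f⁻¹(i,0) = (p,0) with p < i, which is already fixed. If b ≠ 0, then (i,0) being cut from
-- (k,0) for a later row k makes f(k,0) an already fixed zero vertex of an earlier row. So
-- f(i,0) = (i,0) by injectivity, and cuts with these fixed vertices show that f preserves every
-- row. Hence Aut(Γ'(n,v)) is the group of families of column permutations, one per row, fixing
-- column 0 on all rows but the last.

module Submission where

open import Defs
open import Level using (0ℓ)
open import Data.Empty using (⊥)
open import Data.Nat using (ℕ; zero; suc; _≤_; _*_; _^_; _∸_; _!; s≤s)
import Data.Nat as ℕ
import Data.Nat.Properties as ℕ
open import Data.Fin using (Fin; zero; suc; toℕ; fromℕ; inject₁; punchIn; _<_)
import Data.Fin as Fin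
open import Data.Fin.Properties
  using (*↔×; toℕ-injective; suc-injective; _<?_; <-irrefl; ≤-antisym; punchIn-injective; punchInᵢ≢i;
         toℕ-fromℕ; ≤fromℕ; inject₁ℕ<)
open import Data.Fin.Induction using (<-wellFounded)
open import Data.Fin.Permutation
  using (Permutation′; _⟨$⟩ʳ_; _⟨$⟩ˡ_; _≈_; _∘ₚ_; id; flip; permutation; inverseˡ; inverseʳ;
         insert; remove; lift₀; lift₀-cong; insert-punchIn; insert-remove; remove-insert)
open import Data.Fin.Relation.Unary.Top using (View; view; ‵fromℕ; ‵inject₁; view-fromℕ; view-inject₁)
open import Data.Product using (_×_; _,_; proj₁; proj₂; Σ)
open import Data.Product.Relation.Binary.Pointwise.NonDependent using (_×ₛ_; Pointwise-≡↔≡)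
open import Data.Product.Function.NonDependent.Setoid using (_×-inverse_)
open import Data.Vec.Functional using (_∷_; head; tail)
import Data.Vec.Functional.Relation.Binary.Pointwise.Properties as Vectorʷ
open import Function using (_∘_)
open import Function.Bundles using (Bijection; module Bijection; Inverse; _↔_; _⇔_; Equivalence; mk↔ₛ′; mk⇔)
open import Function.Definitions using (Congruent; StrictlyInverseˡ; StrictlyInverseʳ)
open import Function.Consequences.Setoid using (strictlyInverseˡ⇒inverseˡ; strictlyInverseʳ⇒inverseʳ)
open import Function.Properties.Inverse using (Inverse⇒Bijection)
import Function.Construct.Composition as Compose
import Function.Construct.Identity as Identity
import Function.Construct.Symmetry as Symmetry
import Relation.Binary.Reasoning.Setoid as SetoidReasoning
open import Induction.WellFounded using (Acc; acc)
open import Relation.Binary.Bundles using (Setoid)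
open import Relation.Binary.PropositionalEquality
  using (_≡_; _≢_; refl; sym; trans; cong; cong₂; subst; subst₂; setoid; module ≡-Reasoning)
open import Relation.Nullary using (¬_; Dec; yes; no; contradiction)
open import Relation.Nullary.Decidable using (_×-dec_)

private
  variable
    k n v w : ℕ

mkInverseₛ : {S T : Setoid 0ℓ 0ℓ}
             (to : Setoid.Carrier S → Setoid.Carrier T) (from : Setoid.Carrier T → Setoid.Carrier S) →
             Congruent (Setoid._≈_ S) (Setoid._≈_ T) to → Congruent (Setoid._≈_ T) (Setoid._≈_ S) from →
             StrictlyInverseˡ (Setoid._≈_ T) to from → StrictlyInverseʳ (Setoid._≈_ S) to from → Inverse S T
mkInverseₛ {S} {T} to from to-cong from-cong invˡ invʳ = record
  { to = to ; from = from ; to-cong = to-cong ; from-cong = from-cong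
  ; inverse = strictlyInverseˡ⇒inverseˡ S T to-cong invˡ , strictlyInverseʳ⇒inverseʳ S T from-cong invʳ }

Sym-setoid : ℕ → Setoid 0ℓ 0ℓ
Sym-setoid k = record
  { Carrier = Permutation′ k
  ; _≈_ = _≈_
  ; isEquivalence = record
    { refl = λ _ → refl ; sym = λ p i → sym (p i) ; trans = λ p q i → trans (p i) (q i) } }

×-inverse-Fin* : {A B : Setoid 0ℓ 0ℓ} {a b : ℕ} →
  Inverse A (setoid (Fin a)) → Inverse B (setoid (Fin b)) → Inverse (A ×ₛ B) (setoid (Fin (a * b)))
×-inverse-Fin* f g = Compose.inverse (Compose.inverse (f ×-inverse g) Pointwise-≡↔≡) (Symmetry.inverse *↔×)

Vector-suc-inverse : (S : Setoid 0ℓ 0ℓ) (k : ℕ) →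
  Inverse (Vectorʷ.setoid S (suc k)) (S ×ₛ Vectorʷ.setoid S k)
Vector-suc-inverse S k = mkInverseₛ (λ xs → head xs , tail xs) (λ (x , xs) → x ∷ xs)
  (λ p → p zero , λ i → p (suc i))
  (λ { (p , ps) zero → p ; (p , ps) (suc i) → ps i })
  (λ _ → S.refl , λ _ → S.refl)
  (λ { xs zero → S.refl ; xs (suc i) → S.refl })
  where module S = Setoid S

Vector-inverse-Fin^ : {S : Setoid 0ℓ 0ℓ} {a : ℕ} → Inverse S (setoid (Fin a)) →
  ∀ k → Inverse (Vectorʷ.setoid S k) (setoid (Fin (a ^ k)))
Vector-inverse-Fin^ f zero =
  mkInverseₛ (λ _ → zero) (λ _ ()) (λ _ → refl) (λ _ ()) (λ { zero → refl }) (λ _ ())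
Vector-inverse-Fin^ {S} f (suc k) =
  Compose.inverse (Vector-suc-inverse S k) (×-inverse-Fin* f (Vector-inverse-Fin^ f k))

punchIn-remove : (π : Permutation′ (suc k)) (i : Fin k) →
  punchIn (π ⟨$⟩ʳ zero) (remove zero π ⟨$⟩ʳ i) ≡ π ⟨$⟩ʳ suc i
punchIn-remove π i = begin
  punchIn (π ⟨$⟩ʳ zero) (remove zero π ⟨$⟩ʳ i)
    ≡⟨ insert-punchIn zero (π ⟨$⟩ʳ zero) (remove zero π) i ⟨
  insert zero (π ⟨$⟩ʳ zero) (remove zero π) ⟨$⟩ʳ suc i
    ≡⟨ insert-remove zero π (suc i) ⟩
  π ⟨$⟩ʳ suc i
    ∎
  where open ≡-Reasoning

remove-cong : (π ρ : Permutation′ (suc k)) → π ≈ ρ → remove zero π ≈ remove zero ρ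
remove-cong π ρ π≈ρ i = punchIn-injective (π ⟨$⟩ʳ zero) _ _ (begin
  punchIn (π ⟨$⟩ʳ zero) (remove zero π ⟨$⟩ʳ i)  ≡⟨ punchIn-remove π i ⟩
  π ⟨$⟩ʳ suc i                                   ≡⟨ π≈ρ (suc i) ⟩
  ρ ⟨$⟩ʳ suc i                                   ≡⟨ punchIn-remove ρ i ⟨
  punchIn (ρ ⟨$⟩ʳ zero) (remove zero ρ ⟨$⟩ʳ i)  ≡⟨ cong (λ a → punchIn a _) (π≈ρ zero) ⟨
  punchIn (π ⟨$⟩ʳ zero) (remove zero ρ ⟨$⟩ʳ i)  ∎)
  where open ≡-Reasoning

insert-cong : (a : Fin (suc k)) (π ρ : Permutation′ k) → π ≈ ρ → insert zero a π ≈ insert zero a ρ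
insert-cong a π ρ π≈ρ zero = refl
insert-cong a π ρ π≈ρ (suc i) = begin
  insert zero a π ⟨$⟩ʳ suc i  ≡⟨ insert-punchIn zero a π i ⟩
  punchIn a (π ⟨$⟩ʳ i)        ≡⟨ cong (punchIn a) (π≈ρ i) ⟩
  punchIn a (ρ ⟨$⟩ʳ i)        ≡⟨ insert-punchIn zero a ρ i ⟨
  insert zero a ρ ⟨$⟩ʳ suc i  ∎
  where open ≡-Reasoning

Sym-suc-inverse : ∀ k → Inverse (Sym-setoid (suc k)) (setoid (Fin (suc k)) ×ₛ Sym-setoid k)
Sym-suc-inverse k = mkInverseₛ (λ π → π ⟨$⟩ʳ zero , remove zero π) (λ (a , π) → insert zero a π)
  (λ {π} {ρ} π≈ρ → π≈ρ zero , remove-cong π ρ π≈ρ)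
  (λ { {a , π} {_ , ρ} (refl , π≈ρ) → insert-cong a π ρ π≈ρ })
  (λ (a , π) → refl , remove-insert zero a π)
  (insert-remove zero)

Sym-inverse-Fin! : ∀ k → Inverse (Sym-setoid k) (setoid (Fin (k !)))
Sym-inverse-Fin! zero =
  mkInverseₛ (λ _ → zero) (λ _ → id) (λ _ → refl) (λ _ ()) (λ { zero → refl }) (λ _ ())
Sym-inverse-Fin! (suc k) =
  Compose.inverse (Sym-suc-inverse k) (×-inverse-Fin* (Identity.inverse (setoid (Fin (suc k)))) (Sym-inverse-Fin! k))

remove-zero-suc : (π : Permutation′ (suc v)) → π ⟨$⟩ʳ zero ≡ zero →
  ∀ i → suc (remove zero π ⟨$⟩ʳ i) ≡ π ⟨$⟩ʳ suc i
remove-zero-suc π π0≡0 i =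
  subst (λ a → punchIn a (remove zero π ⟨$⟩ʳ i) ≡ π ⟨$⟩ʳ suc i) π0≡0 (punchIn-remove π i)

lift₀-remove : (π : Permutation′ (suc v)) → π ⟨$⟩ʳ zero ≡ zero → lift₀ (remove zero π) ≈ π
lift₀-remove π π0≡0 zero    = sym π0≡0
lift₀-remove π π0≡0 (suc i) = remove-zero-suc π π0≡0 i

remove-lift₀ : (π : Permutation′ v) → remove zero (lift₀ π) ≈ π
remove-lift₀ π i = suc-injective (remove-zero-suc (lift₀ π) refl i)

remove-∘ₚ : (π ρ : Permutation′ (suc v)) → π ⟨$⟩ʳ zero ≡ zero → ρ ⟨$⟩ʳ zero ≡ zero →
  remove zero (π ∘ₚ ρ) ≈ remove zero π ∘ₚ remove zero ρ
remove-∘ₚ π ρ π0≡0 ρ0≡0 i = suc-injective (begin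
  suc (remove zero (π ∘ₚ ρ) ⟨$⟩ʳ i)              ≡⟨ remove-zero-suc (π ∘ₚ ρ) πρ0≡0 i ⟩
  ρ ⟨$⟩ʳ (π ⟨$⟩ʳ suc i)                          ≡⟨ cong (ρ ⟨$⟩ʳ_) (remove-zero-suc π π0≡0 i) ⟨
  ρ ⟨$⟩ʳ suc (remove zero π ⟨$⟩ʳ i)              ≡⟨ remove-zero-suc ρ ρ0≡0 _ ⟨
  suc (remove zero ρ ⟨$⟩ʳ (remove zero π ⟨$⟩ʳ i)) ∎)
  where
  open ≡-Reasoning
  πρ0≡0 : (π ∘ₚ ρ) ⟨$⟩ʳ zero ≡ zero
  πρ0≡0 = trans (cong (ρ ⟨$⟩ʳ_) π0≡0) ρ0≡0

fixes-zero⇒preimage-zero : (π : Permutation′ (suc v)) {j : Fin (suc v)} →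
  π ⟨$⟩ʳ zero ≡ zero → π ⟨$⟩ʳ j ≡ zero → j ≡ zero
fixes-zero⇒preimage-zero π {j} π0≡0 πj≡0 = begin
  j                      ≡⟨ inverseˡ π ⟨
  π ⟨$⟩ˡ (π ⟨$⟩ʳ j)      ≡⟨ cong (π ⟨$⟩ˡ_) (trans πj≡0 (sym π0≡0)) ⟩
  π ⟨$⟩ˡ (π ⟨$⟩ʳ zero)   ≡⟨ inverseˡ π ⟩
  zero                   ∎
  where open ≡-Reasoning

FixesZeroOffLastRow : (Fin n → Permutation′ (suc v)) → Set
FixesZeroOffLastRow {n} ρ = ∀ {r k : Fin n} → r < k → ρ r ⟨$⟩ʳ zero ≡ zero

module _ {m v : ℕ} where

  inject₁<fromℕ : ∀ (i : Fin m) → inject₁ i < fromℕ m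
  inject₁<fromℕ i = subst (ℕ._<_ _) (sym (toℕ-fromℕ m)) (inject₁ℕ< i)

  fromℕ-or-inject₁ : (P : Fin (suc m) → Set) → P (fromℕ m) → (∀ i → P (inject₁ i)) → ∀ r → P r
  fromℕ-or-inject₁ P p-last p-inject₁ r = go (view r)
    where
    go : ∀ {r} → View r → P r
    go ‵fromℕ       = p-last
    go (‵inject₁ i) = p-inject₁ i

  split : (Fin (suc m) → Permutation′ (suc v)) → Permutation′ (suc v) × (Fin m → Permutation′ v)
  split ρ = ρ (fromℕ m) , λ i → remove zero (ρ (inject₁ i))

  join : Permutation′ (suc v) × (Fin m → Permutation′ v) → Fin (suc m) → Permutation′ (suc v)
  join (σ , τ) = fromℕ-or-inject₁ _ σ (lift₀ ∘ τ)

  join-fromℕ : ∀ στ → join στ (fromℕ m) ≡ proj₁ στ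
  join-fromℕ _ rewrite view-fromℕ m = refl

  join-inject₁ : ∀ στ i → join στ (inject₁ i) ≡ lift₀ (proj₂ στ i)
  join-inject₁ _ i rewrite view-inject₁ i = refl

  join-fixes-zero : ∀ στ → FixesZeroOffLastRow (join στ)
  join-fixes-zero στ {r} = fromℕ-or-inject₁ (λ r → ∀ {k} → r < k → join στ r ⟨$⟩ʳ zero ≡ zero)
    (λ {k} last<k → contradiction (ℕ.<-≤-trans last<k (≤fromℕ k)) (ℕ.<-irrefl refl))
    (λ i _ → cong (_⟨$⟩ʳ zero) (join-inject₁ στ i))
    r

  join-cong : ∀ {στ στ′} → _≈ₚ_ {suc m} {suc v} στ στ′ → ∀ r → join στ r ≈ join στ′ r
  join-cong {στ} {στ′} (σ≈σ′ , τ≈τ′) = fromℕ-or-inject₁ (λ r → join στ r ≈ join στ′ r)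
    (subst₂ _≈_ (sym (join-fromℕ στ)) (sym (join-fromℕ στ′)) σ≈σ′)
    (λ i → subst₂ _≈_ (sym (join-inject₁ στ i)) (sym (join-inject₁ στ′ i))
                      (lift₀-cong _ _ (τ≈τ′ i)))

  split-cong : ∀ ρ ρ′ → (∀ r → ρ r ≈ ρ′ r) → _≈ₚ_ {suc m} {suc v} (split ρ) (split ρ′)
  split-cong ρ ρ′ ρ≈ρ′ =
    ρ≈ρ′ (fromℕ m) , λ i → remove-cong (ρ (inject₁ i)) (ρ′ (inject₁ i)) (ρ≈ρ′ (inject₁ i))

  split-join : ∀ στ → _≈ₚ_ {suc m} {suc v} (split (join στ)) στ
  split-join στ@(σ , τ) =
    (λ j → cong (_⟨$⟩ʳ j) (join-fromℕ στ)) , λ i j → trans (remove-join-inject₁ i j) (remove-lift₀ (τ i) j)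
    where
    remove-join-inject₁ : ∀ i → remove zero (join στ (inject₁ i)) ≈ remove zero (lift₀ (τ i))
    remove-join-inject₁ i =
      remove-cong (join στ (inject₁ i)) (lift₀ (τ i)) (λ j → cong (_⟨$⟩ʳ j) (join-inject₁ στ i))

  join-split : ∀ ρ → FixesZeroOffLastRow ρ → ∀ r → join (split ρ) r ≈ ρ r
  join-split ρ fixes-zero = fromℕ-or-inject₁ (λ r → join (split ρ) r ≈ ρ r)
    (λ j → cong (_⟨$⟩ʳ j) (join-fromℕ (split ρ)))
    (λ i j → trans (cong (_⟨$⟩ʳ j) (join-inject₁ (split ρ) i))
                   (lift₀-remove (ρ (inject₁ i)) (fixes-zero (inject₁<fromℕ i)) j))

  split-∘ₚ : ∀ ρ ρ′ → FixesZeroOffLastRow ρ → FixesZeroOffLastRow ρ′ →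
    _≈ₚ_ {suc m} {suc v} (split (λ r → ρ r ∘ₚ ρ′ r)) (_∙ₚ_ {suc m} {suc v} (split ρ) (split ρ′))
  split-∘ₚ ρ ρ′ fixes-zero fixes-zero′ = (λ _ → refl) , λ i →
    remove-∘ₚ (ρ (inject₁ i)) (ρ′ (inject₁ i)) (fixes-zero (inject₁<fromℕ i)) (fixes-zero′ (inject₁<fromℕ i))

-- A data type rather than Removed x y ⊎ Removed y x, so that x and y can be inferred.
data Cut (x y : Vertex n v) : Set where
  removed  : Removed x y → Cut x y
  removed˘ : Removed y x → Cut x y

Cut-sym : ∀ {x y : Vertex n v} → Cut x y → Cut y x
Cut-sym (removed r)  = removed˘ r
Cut-sym (removed˘ r) = removed r

Removed? : (x y : Vertex n v) → Dec (Removed x y)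
Removed? (i , j) (k , _) = (toℕ j ℕ.≟ 0) ×-dec (i <? k)

Cut? : (x y : Vertex n v) → Dec (Cut x y)
Cut? x y with Removed? x y | Removed? y x
... | yes r | _     = yes (removed r)
... | _     | yes r = yes (removed˘ r)
... | no ¬r | no ¬r˘ = no λ { (removed r) → ¬r r ; (removed˘ r) → ¬r˘ r }

Cut-same-row : ∀ {a : Fin n} {b c : Fin v} → ¬ Cut (a , b) (a , c)
Cut-same-row (removed (_ , a<a)) = <-irrefl refl a<a
Cut-same-row (removed˘ (_ , a<a)) = <-irrefl refl a<a

Cut⇒≢ : ∀ {x y : Vertex n v} → Cut x y → x ≢ y
Cut⇒≢ cut refl = Cut-same-row cut

Cut⇒¬Adj : ∀ {x y : Vertex n v} → Cut x y → ¬ Adj x y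
Cut⇒¬Adj (removed r) (_ , ¬r , _) = ¬r r
Cut⇒¬Adj (removed˘ r) (_ , _ , ¬r) = ¬r r

Cut-zero-above : ∀ {i k : Fin n} {j : Fin (suc v)} → i < k → Cut (i , zero) (k , j)
Cut-zero-above i<k = removed (refl , i<k)

Cut-at-nonzero : ∀ {p k : Fin n} {q : Fin (suc v)} {j : Fin v} → Cut (p , q) (k , suc j) → q ≡ zero × p < k
Cut-at-nonzero (removed (q≡0 , p<k)) = toℕ-injective q≡0 , p<k

¬Cut-zero⇒≤ : ∀ {i k : Fin n} {j : Fin (suc v)} → ¬ Cut (i , zero) (k , j) → k Fin.≤ i
¬Cut-zero⇒≤ ¬cut = ℕ.≮⇒≥ (¬cut ∘ Cut-zero-above)

¬Cut-zero⇒≡ : ∀ {i k : Fin n} → ¬ Cut {v = suc v} (i , zero) (k , zero) → k ≡ i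
¬Cut-zero⇒≡ ¬cut = ≤-antisym (¬Cut-zero⇒≤ ¬cut) (ℕ.≮⇒≥ λ k<i → ¬cut (removed˘ (refl , k<i)))

infix 10 _⁻¹ₐ

_⁻¹ₐ : Aut n v → Aut n v
A ⁻¹ₐ = record
  { perm = Symmetry.↔-sym (perm A)
  ; preserve = λ x y adj → reflect A _ _ (subst₂ Adj (sym (app-inv x)) (sym (app-inv y)) adj)
  ; reflect = λ x y adj → subst₂ Adj (app-inv x) (app-inv y) (preserve A _ _ adj)
  }
  where
  app-inv : ∀ x → Inverse.to (perm A) (Inverse.from (perm A) x) ≡ x
  app-inv = Inverse.strictlyInverseˡ (perm A)

module _ (A : Aut n v) where

  app-⁻¹ₐ : ∀ x → app A (app (A ⁻¹ₐ) x) ≡ x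
  app-⁻¹ₐ = Inverse.strictlyInverseˡ (perm A)

  ⁻¹ₐ-app : ∀ x → app (A ⁻¹ₐ) (app A x) ≡ x
  ⁻¹ₐ-app = Inverse.strictlyInverseʳ (perm A)

  app-injective : ∀ {x y} → app A x ≡ app A y → x ≡ y
  app-injective {x} {y} eq = trans (sym (⁻¹ₐ-app x)) (trans (cong (app (A ⁻¹ₐ)) eq) (⁻¹ₐ-app y))

  cut-preserve : ∀ {x y} → Cut x y → Cut (app A x) (app A y)
  cut-preserve {x} {y} cut with Cut? (app A x) (app A y)
  ... | yes cut′ = cut′
  ... | no ¬cut′ = contradiction (reflect A x y adj) (Cut⇒¬Adj cut)
    where
    adj : Adj (app A x) (app A y)
    adj = Cut⇒≢ cut ∘ app-injective , ¬cut′ ∘ removed , ¬cut′ ∘ removed˘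

cut-reflect : (A : Aut n v) → ∀ {x y} → Cut (app A x) (app A y) → Cut x y
cut-reflect A cut = subst₂ Cut (⁻¹ₐ-app A _) (⁻¹ₐ-app A _) (cut-preserve (A ⁻¹ₐ) cut)

module Rigidity (A : Aut n (suc (suc w))) where

  private
    f = app A
    g = app (A ⁻¹ₐ)

  FixesZerosBelow : Fin n → Set
  FixesZerosBelow i = ∀ p → p < i → f (p , zero) ≡ (p , zero)

  zero-image-row≤ : ∀ {i} → FixesZerosBelow i → proj₁ (f (i , zero)) Fin.≤ i
  zero-image-row≤ {i} fixed = ℕ.≮⇒≥ row-grows-absurd
    where
    a = proj₁ (f (i , zero))
    b = proj₂ (f (i , zero))
    c = punchIn b zero  -- a second column; this needs v ≥ 2
    row-grows-absurd : i < a → ⊥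
    row-grows-absurd i<a = preimage-absurd (g (a , c)) (app-⁻¹ₐ A (a , c))
      where
      ¬cut : ∀ {y} → f y ≡ (a , c) → ¬ Cut (i , zero) y
      ¬cut fy≡ac cut = Cut-same-row (subst₂ Cut refl fy≡ac (cut-preserve A cut))
      preimage-absurd : ∀ y → f y ≡ (a , c) → ⊥
      preimage-absurd (k , zero) fy≡ac = punchInᵢ≢i b zero (cong proj₂ (begin
        (a , c)           ≡⟨ fy≡ac ⟨
        f (k , zero)      ≡⟨ cong (λ k → f (k , zero)) (¬Cut-zero⇒≡ (¬cut fy≡ac)) ⟩
        f (i , zero)      ∎))
        where open ≡-Reasoning
      preimage-absurd (k , suc j) fy≡ac = zero-preimage-absurd (g (i , zero)) (app-⁻¹ₐ A (i , zero))
        where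
        zero-preimage-absurd : ∀ x → f x ≡ (i , zero) → ⊥
        zero-preimage-absurd (p , q) fx≡i0
          with Cut-at-nonzero (cut-reflect A (subst₂ Cut (sym fx≡i0) (sym fy≡ac) (Cut-zero-above i<a)))
        ... | refl , p<k = <-irrefl (cong proj₁ (trans (sym (fixed p p<i)) fx≡i0)) p<i
          where
          p<i : p < i
          p<i = ℕ.<-≤-trans p<k (¬Cut-zero⇒≤ (¬cut fy≡ac))

  zero-image-col≡zero : ∀ {i k} → FixesZerosBelow i → i < k →
    proj₁ (f (i , zero)) Fin.≤ i → proj₂ (f (i , zero)) ≡ zero
  zero-image-col≡zero {i} {k} fixed i<k a≤i = column-is-zero refl
    where
    a = proj₁ (f (i , zero))
    column-is-zero : ∀ {b} → proj₂ (f (i , zero)) ≡ b → b ≡ zero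
    column-is-zero {zero} _ = refl
    column-is-zero {suc b} b≡ =
      contradiction (ℕ.<-trans c<i i<k) (<-irrefl (sym (cong proj₁ (app-injective A k0≡c0))))
      where
      cut : Cut (f (k , zero)) (a , suc b)
      cut = Cut-sym (subst₂ Cut (cong (a ,_) b≡) refl (cut-preserve A (Cut-zero-above i<k)))
      c = proj₁ (f (k , zero))
      c<i : c < i
      c<i = ℕ.<-≤-trans (proj₂ (Cut-at-nonzero cut)) a≤i
      k0≡c0 : f (k , zero) ≡ f (c , zero)
      k0≡c0 = trans (cong (c ,_) (proj₁ (Cut-at-nonzero cut))) (sym (fixed c c<i))

  zero-fixed-step : ∀ {i k} → FixesZerosBelow i → i < k → f (i , zero) ≡ (i , zero)
  zero-fixed-step {i} fixed i<k = cong₂ _,_ a≡i b≡zero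
    where
    a = proj₁ (f (i , zero))
    a≤i : a Fin.≤ i
    a≤i = zero-image-row≤ fixed
    b≡zero : proj₂ (f (i , zero)) ≡ zero
    b≡zero = zero-image-col≡zero fixed i<k a≤i
    a≡i : a ≡ i
    a≡i = ≤-antisym a≤i (ℕ.≮⇒≥ λ a<i →
      <-irrefl (cong proj₁ (app-injective A (trans (fixed a a<i) (sym (cong (a ,_) b≡zero))))) a<i)

  zero-fixed : ∀ {i k} → i < k → f (i , zero) ≡ (i , zero)
  zero-fixed {i} i<k = go (<-wellFounded i) i<k
    where
    go : ∀ {i k} → Acc _<_ i → i < k → f (i , zero) ≡ (i , zero)
    go (acc below) i<k = zero-fixed-step (λ p p<i → go (below p<i) (ℕ.<-trans p<i i<k)) i<k

  row-preserved : ∀ i j → proj₁ (f (i , j)) ≡ i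
  row-preserved i j = ≤-antisym (ℕ.≮⇒≥ row-grows-absurd) (ℕ.≮⇒≥ row-shrinks-absurd)
    where
    a = proj₁ (f (i , j))
    row-grows-absurd : ¬ i < a
    row-grows-absurd i<a =
      Cut-same-row (cut-reflect A (subst₂ Cut (sym (zero-fixed i<a)) refl (Cut-zero-above i<a)))
    row-shrinks-absurd : ¬ a < i
    row-shrinks-absurd a<i =
      Cut-same-row (subst₂ Cut (zero-fixed a<i) refl (cut-preserve A (Cut-zero-above a<i)))

app-on-row : (A : Aut n (suc (suc w))) → ∀ r j → app A (r , j) ≡ (r , proj₂ (app A (r , j)))
app-on-row A r j = cong (_, proj₂ (app A (r , j))) (Rigidity.row-preserved A r j)

rowPermutation : Aut n (suc (suc w)) → Fin n → Permutation′ (suc (suc w))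
rowPermutation A r = permutation (λ j → proj₂ (app A (r , j))) (λ j → proj₂ (app (A ⁻¹ₐ) (r , j)))
  (λ j → cong proj₂ (trans (cong (app A) (sym (app-on-row (A ⁻¹ₐ) r j))) (app-⁻¹ₐ A (r , j))))
  (λ j → cong proj₂ (trans (cong (app (A ⁻¹ₐ)) (sym (app-on-row A r j))) (⁻¹ₐ-app A (r , j))))

rowPermutation-fixes-zero : (A : Aut n (suc (suc w))) → FixesZeroOffLastRow (rowPermutation A)
rowPermutation-fixes-zero A r<k = cong proj₂ (Rigidity.zero-fixed A r<k)

rowPermutation-∘ₐ : (g h : Aut n (suc (suc w))) →
  ∀ r → rowPermutation (g ∘ₐ h) r ≈ rowPermutation g r ∘ₚ rowPermutation h r
rowPermutation-∘ₐ g h r j = cong (λ x → proj₂ (app h x)) (app-on-row g r j)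

Removed-preserving-Aut : (h : Vertex n v ↔ Vertex n v) →
  (∀ x y → Removed x y ⇔ Removed (Inverse.to h x) (Inverse.to h y)) → Aut n v
Removed-preserving-Aut h removed⇔ = record
  { perm = h
  ; preserve = λ x y (x≢y , ¬r , ¬r˘) →
      x≢y ∘ injective , ¬r ∘ Equivalence.from (removed⇔ x y) , ¬r˘ ∘ Equivalence.from (removed⇔ y x)
  ; reflect = λ x y (hx≢hy , ¬r , ¬r˘) →
      hx≢hy ∘ cong (Inverse.to h) , ¬r ∘ Equivalence.to (removed⇔ x y) , ¬r˘ ∘ Equivalence.to (removed⇔ y x)
  }
  where
  injective : ∀ {x y} → Inverse.to h x ≡ Inverse.to h y → x ≡ y
  injective {x} {y} eq = begin
    x                                ≡⟨ Inverse.strictlyInverseʳ h x ⟨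
    Inverse.from h (Inverse.to h x)  ≡⟨ cong (Inverse.from h) eq ⟩
    Inverse.from h (Inverse.to h y)  ≡⟨ Inverse.strictlyInverseʳ h y ⟩
    y                                ∎
    where open ≡-Reasoning

rowwise : (Fin n → Permutation′ v) → Vertex n v → Vertex n v
rowwise ρ (r , j) = r , ρ r ⟨$⟩ʳ j

rowwise-↔ : (Fin n → Permutation′ v) → Vertex n v ↔ Vertex n v
rowwise-↔ ρ = mk↔ₛ′ (rowwise ρ) (rowwise (flip ∘ ρ))
  (λ (r , j) → cong (r ,_) (inverseʳ (ρ r)))
  (λ (r , j) → cong (r ,_) (inverseˡ (ρ r)))

Removed-rowwise : (ρ : Fin n → Permutation′ (suc v)) → FixesZeroOffLastRow ρ →
  ∀ x y → Removed x y ⇔ Removed (rowwise ρ x) (rowwise ρ y)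
Removed-rowwise ρ fixes-zero (r , j) (k , l) = mk⇔
  (λ (j≡0 , r<k) → cong toℕ (trans (cong (ρ r ⟨$⟩ʳ_) (toℕ-injective j≡0)) (fixes-zero r<k)) , r<k)
  (λ (ρj≡0 , r<k) →
    cong toℕ (fixes-zero⇒preimage-zero (ρ r) (fixes-zero r<k) (toℕ-injective ρj≡0)) , r<k)

rowwiseAut : (ρ : Fin n → Permutation′ (suc v)) → FixesZeroOffLastRow ρ → Aut n (suc v)
rowwiseAut ρ fixes-zero = Removed-preserving-Aut (rowwise-↔ ρ) (Removed-rowwise ρ fixes-zero)

module _ {m w : ℕ} where

  private
    module Prodₛ = Setoid (ProdSetoid (suc m) (suc (suc w)))

  toProd : Aut (suc m) (suc (suc w)) → Prod (suc m) (suc (suc w))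
  toProd A = split (rowPermutation A)

  fromProd : Prod (suc m) (suc (suc w)) → Aut (suc m) (suc (suc w))
  fromProd στ = rowwiseAut (join στ) (join-fixes-zero στ)

  toProd-cong : ∀ {A B} → A ≈ₐ B → toProd A Prodₛ.≈ toProd B
  toProd-cong {A} {B} A≈B =
    split-cong (rowPermutation A) (rowPermutation B) (λ r j → cong proj₂ (A≈B (r , j)))

  fromProd-cong : ∀ {στ στ′} → στ Prodₛ.≈ στ′ → fromProd στ ≈ₐ fromProd στ′
  fromProd-cong {στ} {στ′} στ≈στ′ (r , j) = cong (r ,_) (join-cong {στ = στ} {στ′} στ≈στ′ r j)

  toProd-fromProd : ∀ στ → toProd (fromProd στ) Prodₛ.≈ στ
  toProd-fromProd στ = begin
    toProd (fromProd στ)  ≈⟨ split-cong (rowPermutation (fromProd στ)) (join στ) (λ _ _ → refl) ⟩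
    split (join στ)       ≈⟨ split-join στ ⟩
    στ                    ∎
    where open SetoidReasoning (ProdSetoid (suc m) (suc (suc w)))

  fromProd-toProd : ∀ A → fromProd (toProd A) ≈ₐ A
  fromProd-toProd A (r , j) = begin
    (r , join (split (rowPermutation A)) r ⟨$⟩ʳ j)
      ≡⟨ cong (r ,_) (join-split (rowPermutation A) (rowPermutation-fixes-zero A) r j) ⟩
    (r , rowPermutation A r ⟨$⟩ʳ j)
      ≡⟨ app-on-row A r j ⟨
    app A (r , j)
      ∎
    where open ≡-Reasoning

  Aut-inverse-Prod : Inverse (AutSetoid (suc m) (suc (suc w))) (ProdSetoid (suc m) (suc (suc w)))
  Aut-inverse-Prod = mkInverseₛ toProd fromProd
    (λ {A} {B} → toProd-cong {A} {B}) (λ {στ} {στ′} → fromProd-cong {στ} {στ′}) toProd-fromProd fromProd-toProd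

  toProd-∘ₐ : ∀ g h → toProd (g ∘ₐ h) Prodₛ.≈ _∙ₚ_ {suc m} {suc (suc w)} (toProd g) (toProd h)
  toProd-∘ₐ g h = begin
    toProd (g ∘ₐ h)
      ≈⟨ split-cong (rowPermutation (g ∘ₐ h)) ρ (rowPermutation-∘ₐ g h) ⟩
    split ρ
      ≈⟨ split-∘ₚ (rowPermutation g) (rowPermutation h) (rowPermutation-fixes-zero g) (rowPermutation-fixes-zero h) ⟩
    _∙ₚ_ {suc m} {suc (suc w)} (toProd g) (toProd h)
      ∎
    where
    open SetoidReasoning (ProdSetoid (suc m) (suc (suc w)))
    ρ = λ r → rowPermutation g r ∘ₚ rowPermutation h r

Prod-inverse-Sym×Vector : ∀ k c →
  Inverse (ProdSetoid (suc k) (suc c)) (Sym-setoid (suc c) ×ₛ Vectorʷ.setoid (Sym-setoid c) k)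
Prod-inverse-Sym×Vector k c = mkInverseₛ (λ στ → στ) (λ στ → στ) (λ eq → eq) (λ eq → eq)
  (λ _ → (λ _ → refl) , (λ _ _ → refl)) (λ _ → (λ _ → refl) , (λ _ _ → refl))

Prod-inverse-Fin : ∀ k c → Inverse (ProdSetoid (suc k) (suc c)) (setoid (Fin ((suc c !) * ((c !) ^ k))))
Prod-inverse-Fin k c = Compose.inverse (Prod-inverse-Sym×Vector k c)
  (×-inverse-Fin* (Sym-inverse-Fin! (suc c)) (Vector-inverse-Fin^ (Sym-inverse-Fin! c) k))

proposition3p7 : (n v : ℕ) → 2 ≤ n → 2 ≤ v →
    Bijection (AutSetoid n v) (setoid (Fin ((v !) * (((v ∸ 1) !) ^ (n ∸ 1)))))
    × Σ (Bijection (AutSetoid n v) (ProdSetoid n v))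
        (λ φ → ∀ g h → _≈ₚ_ {n} {v} (Bijection.to φ (g ∘ₐ h)) (_∙ₚ_ {n} {v} (Bijection.to φ g) (Bijection.to φ h)))
proposition3p7 (suc m) (suc (suc w)) (s≤s _) (s≤s (s≤s _)) =
    Inverse⇒Bijection (Compose.inverse Aut-inverse-Prod (Prod-inverse-Fin m (suc w)))
  , Inverse⇒Bijection Aut-inverse-Prod
  , toProd-∘ₐ
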